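{- Let $G$ be a connected graph of order at least three. If $D$ is a $\gamma_{\rm cer}$-set of $G$ and $D$ contains a leaf of $G$, then $D$ is not a $\gamma$-set of $G$. Equivalently, if $D$ is a $\gamma_{\rm cer}$-set of $G$ and $\gamma(G)=\gamma_{\rm cer}(G)$, then $D$ contains no leaf of $G$ and $D$ contains every support vertex of $G$.
   Context: All graphs are finite and simple. A leaf is a vertex of degree one; a support is a vertex adjacent to a leaf. A set $D\subseteq V_G$ is a dominating set of $G$ if every vertex of $V_G-D$ is adjacent to at least one vertex of $D$; $\gamma(G)$ is the minimum cardinality of a dominating set, and a $\gamma$-set is a dominating set of cardinality $\gamma(G)$. A set $D\subseteq V_G$ is a certified dominating set of $G$ if $D$ is a dominating set of $G$ and every vertex in $D$ has either zero or at least two neighbors in $V_G-D$; $\gamma_{\rm cer}(G)$ is the minimum cardinality of a certified dominating set, and a $\gamma_{\rm cer}$-set is a certified dominating set of cardinality $\gamma_{\rm cer}(G)$. -}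

module Defs where

open import Data.Nat using (ℕ; zero; suc; _≤_)
open import Data.Bool using (Bool; true; false)
open import Data.Fin using (Fin)
open import Data.Fin.Subset using (Subset; _∈_; _∉_; ∁; _∩_; ∣_∣)
open import Data.Vec using (tabulate)
open import Data.Product using (Σ; ∃; _×_)
open import Data.Sum using (_⊎_)
open import Relation.Binary.PropositionalEquality using (_≡_)

record Graph : Set where
  field
    n     : ℕ
    adj   : Fin n → Fin n → Bool
    sym   : ∀ u v → adj u v ≡ adj v u
    irref : ∀ v → adj v v ≡ false

open Graph public

module _ (G : Graph) where

  N : Fin (n G) → Subset (n G)
  N v = tabulate (adj G v)

  degree : Fin (n G) → ℕ
  degree v = ∣ N v ∣

  data Reach : Fin (n G) → Fin (n G) → Set where
    here : ∀ {v} → Reach v v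
    step : ∀ {u w v} → adj G u w ≡ true → Reach w v → Reach u v

  Connected : Set
  Connected = ∀ u v → Reach u v

  IsLeaf : Fin (n G) → Set
  IsLeaf v = degree v ≡ 1

  IsSupport : Fin (n G) → Set
  IsSupport v = ∃ λ u → IsLeaf u × adj G v u ≡ true

  IsDominating : Subset (n G) → Set
  IsDominating D = ∀ v → v ∉ D → ∃ λ u → u ∈ D × adj G v u ≡ true

  IsCertified : Subset (n G) → Set
  IsCertified D =
    IsDominating D ×
    (∀ v → v ∈ D → (∣ N v ∩ ∁ D ∣ ≡ 0 ⊎ 2 ≤ ∣ N v ∩ ∁ D ∣))

  IsGammaSet : Subset (n G) → Set
  IsGammaSet D = IsDominating D × (∀ D′ → IsDominating D′ → ∣ D ∣ ≤ ∣ D′ ∣)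

  IsGammaCerSet : Subset (n G) → Set
  IsGammaCerSet D = IsCertified D × (∀ D′ → IsCertified D′ → ∣ D ∣ ≤ ∣ D′ ∣)

  IsDominationNumber : ℕ → Set
  IsDominationNumber k =
    (Σ (Subset (n G)) λ D → IsDominating D × ∣ D ∣ ≡ k) ×
    (∀ D → IsDominating D → k ≤ ∣ D ∣)

  IsCertifiedDominationNumber : ℕ → Set
  IsCertifiedDominationNumber k =
    (Σ (Subset (n G)) λ D → IsCertified D × ∣ D ∣ ≡ k) ×
    (∀ D → IsCertified D → k ≤ ∣ D ∣)

-- A leaf v in a certified dominating set D has its unique neighbour u in D:
-- otherwise v would have exactly one neighbour outside D. Then u already
-- dominates v, and no vertex outside D relied on v (its only neighbour is u),
-- so D - v is a smaller dominating set. When γ = γ_cer every γ_cer-set is a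
-- γ-set, hence contains no leaf, and each leaf outside D must be dominated by
-- its support.
module Submission where

open import Defs hiding (sym)
open import Data.Nat using (ℕ; _≤_; _<_; z≤n; s≤s)
open import Data.Nat.Properties using (≤-trans; <-≤-trans; ≤-reflexive; <-irrefl; <⇒≱)
open import Data.Fin using (Fin; zero; suc; _≟_)
open import Data.Fin.Subset using (Subset; Nonempty; _∈_; _∉_; ∁; _∩_; ∣_∣; _-_; inside; outside)
open import Data.Fin.Subset.Properties
  using (_∈?_; x∈p⇒∣p-x∣<∣p∣; x∈p∧x≢y⇒x∈p-y; x∉p⇒x∈∁p; x∈p∩q⁺; ∣p∩q∣≤∣p∣)
open import Data.Vec using (_∷_; here; there)
open import Data.Vec.Properties using (lookup⇒[]=; []=⇒lookup; lookup∘tabulate)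
open import Data.Product using (Σ; _×_; _,_; proj₁; proj₂)
import Data.Product as Product
open import Data.Sum using (inj₁; inj₂)
open import Data.Bool using (true)
open import Relation.Nullary using (¬_; yes; no; contradiction)
open import Relation.Binary.PropositionalEquality
  using (_≡_; _≢_; refl; sym; trans; subst)

0<∣p∣⇒Nonempty : ∀ {m} (p : Subset m) → 0 < ∣ p ∣ → Nonempty p
0<∣p∣⇒Nonempty (inside  ∷ p) _      = zero , here
0<∣p∣⇒Nonempty (outside ∷ p) 0<∣p∣ = Product.map suc there (0<∣p∣⇒Nonempty p 0<∣p∣)

x∈p⇒0<∣p∣ : ∀ {m} {p : Subset m} {x} → x ∈ p → 0 < ∣ p ∣
x∈p⇒0<∣p∣ x∈p = <-≤-trans (s≤s z≤n) (x∈p⇒∣p-x∣<∣p∣ x∈p)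

x∈p∧y∈p∧x≢y⇒1<∣p∣ : ∀ {m} {p : Subset m} {x y} → x ∈ p → y ∈ p → x ≢ y → 1 < ∣ p ∣
x∈p∧y∈p∧x≢y⇒1<∣p∣ x∈p y∈p x≢y =
  <-≤-trans (s≤s (x∈p⇒0<∣p∣ (x∈p∧x≢y⇒x∈p-y x∈p x≢y))) (x∈p⇒∣p-x∣<∣p∣ y∈p)

module _ (G : Graph) where

  adj⇒∈N : ∀ {v u} → adj G v u ≡ true → u ∈ N G v
  adj⇒∈N {v} {u} vu = lookup⇒[]= u _ (trans (lookup∘tabulate (adj G v) u) vu)

  ∈N⇒adj : ∀ {v u} → u ∈ N G v → adj G v u ≡ true
  ∈N⇒adj {v} {u} u∈Nv = trans (sym (lookup∘tabulate (adj G v) u)) ([]=⇒lookup u∈Nv)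

  adj⇒≢ : ∀ {v u} → adj G v u ≡ true → u ≢ v
  adj⇒≢ {v} vu refl with trans (sym vu) (irref G v)
  ... | ()

  leaf-neighbour : ∀ {v} → IsLeaf G v → Σ (Fin (n G)) λ u → adj G v u ≡ true
  leaf-neighbour {v} leaf =
    Product.map₂ ∈N⇒adj (0<∣p∣⇒Nonempty (N G v) (≤-reflexive (sym leaf)))

  leaf-neighbour-unique : ∀ {v u w} → IsLeaf G v →
    adj G v u ≡ true → adj G v w ≡ true → u ≡ w
  leaf-neighbour-unique {u = u} {w} leaf vu vw with u ≟ w
  ... | yes u≡w = u≡w
  ... | no  u≢w = contradiction (≤-reflexive leaf)
                    (<⇒≱ (x∈p∧y∈p∧x≢y⇒1<∣p∣ (adj⇒∈N vu) (adj⇒∈N vw) u≢w))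

  certified-leaf-neighbour∈ : ∀ {D v u} → IsCertified G D → IsLeaf G v → v ∈ D →
    adj G v u ≡ true → u ∈ D
  certified-leaf-neighbour∈ {D} {v} {u} (_ , certified) leaf v∈D vu with u ∈? D
  ... | yes u∈D = u∈D
  ... | no  u∉D with certified v v∈D
  ...   | inj₁ none = contradiction (x∈p⇒0<∣p∣ (x∈p∩q⁺ (adj⇒∈N vu , x∉p⇒x∈∁p u∉D)))
                        (<-irrefl (sym none))
  ...   | inj₂ many = contradiction (≤-trans (∣p∩q∣≤∣p∣ (N G v) (∁ D)) (≤-reflexive leaf))
                        (<⇒≱ many)

  dominating-without-leaf : ∀ {D v u} → IsDominating G D → IsLeaf G v →
    adj G v u ≡ true → u ∈ D → IsDominating G (D - v)
  dominating-without-leaf {D} {v} {u} dom leaf vu u∈D x x∉D-v with x ≟ v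
  ... | yes refl = u , x∈p∧x≢y⇒x∈p-y u∈D (adj⇒≢ vu) , vu
  ... | no  x≢v with x ∈? D
  ...   | yes x∈D = contradiction (x∈p∧x≢y⇒x∈p-y x∈D x≢v) x∉D-v
  ...   | no  x∉D with dom x x∉D
  ...     | w , w∈D , xw with w ≟ v
  ...       | no  w≢v = w , x∈p∧x≢y⇒x∈p-y w∈D w≢v , xw
  ...       | yes refl = contradiction
                  (subst (_∈ D) (leaf-neighbour-unique leaf vu (trans (Graph.sym G w x) xw)) u∈D)
                  x∉D

  dominating-support∈ : ∀ {D v u} → IsDominating G D → IsLeaf G u → u ∉ D →
    adj G v u ≡ true → v ∈ D
  dominating-support∈ {D} {v} {u} dom leaf u∉D vu with dom u u∉D
  ... | w , w∈D , uw =
    subst (_∈ D) (leaf-neighbour-unique leaf uw (trans (Graph.sym G u v) vu)) w∈D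

  γcer-set-with-leaf⇒¬γ-set : (D : Subset (n G)) → IsGammaCerSet G D →
    Σ (Fin (n G)) (λ v → IsLeaf G v × v ∈ D) → ¬ IsGammaSet G D
  γcer-set-with-leaf⇒¬γ-set D (cer , _) (v , leaf , v∈D) (_ , minimal)
    with leaf-neighbour leaf
  ... | u , vu = <-irrefl refl (<-≤-trans (x∈p⇒∣p-x∣<∣p∣ v∈D) (minimal (D - v) dom-without-v))
    where
    dom-without-v : IsDominating G (D - v)
    dom-without-v = dominating-without-leaf (proj₁ cer) leaf vu
                      (certified-leaf-neighbour∈ cer leaf v∈D vu)

  γ≡γcer⇒γcer-set⇒γ-set : ∀ {D g c} → IsGammaCerSet G D →
    IsDominationNumber G g → IsCertifiedDominationNumber G c → g ≡ c → IsGammaSet G D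
  γ≡γcer⇒γcer-set⇒γ-set ((dom , _) , minimal) (_ , γ-lower) ((D₀ , cer₀ , ∣D₀∣≡c) , _) refl =
    dom , λ D′ dom′ → ≤-trans (minimal D₀ cer₀) (≤-trans (≤-reflexive ∣D₀∣≡c) (γ-lower D′ dom′))

  γ-set⇒leaves∉∧supports∈ : ∀ {D} → IsGammaCerSet G D → IsGammaSet G D →
    (∀ v → IsLeaf G v → v ∉ D) × (∀ v → IsSupport G v → v ∈ D)
  γ-set⇒leaves∉∧supports∈ {D} γcer γ = leaf∉D , support∈D
    where
    leaf∉D : ∀ v → IsLeaf G v → v ∉ D
    leaf∉D v leaf v∈D = γcer-set-with-leaf⇒¬γ-set D γcer (v , leaf , v∈D) γ
    support∈D : ∀ v → IsSupport G v → v ∈ D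
    support∈D v (u , leaf , vu) = dominating-support∈ (proj₁ γ) leaf (leaf∉D u leaf) vu

lemma2p10 : (G : Graph) → Connected G → 3 ≤ n G →
    ((D : Subset (n G)) → IsGammaCerSet G D →
      Σ (Fin (n G)) (λ v → IsLeaf G v × v ∈ D) → ¬ IsGammaSet G D)
    ×
    ((D : Subset (n G)) (g c : ℕ) → IsGammaCerSet G D →
      IsDominationNumber G g → IsCertifiedDominationNumber G c → g ≡ c →
      (∀ v → IsLeaf G v → v ∉ D) × (∀ v → IsSupport G v → v ∈ D))
lemma2p10 G _ _ =
    γcer-set-with-leaf⇒¬γ-set G
  , λ D g c γcer γ γcer-num g≡c →
      γ-set⇒leaves∉∧supports∈ G γcer (γ≡γcer⇒γcer-set⇒γ-set G γcer γ γcer-num g≡c)
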